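{- For every positive integer $m$, \[ {}_{H}w_{m}(x)=(1+x-m)\,w_{m-1}(x)+(1+x)\sum_{k=1}^{m-1}\binom{m}{k}w_{k-1}(x)\,w_{m-k}(x). \]
   Context: $\left\{ {n \atop k}\right\}$ denotes the Stirling number of the second kind. $H_k=\sum_{i=1}^k 1/i$ is the $k$-th harmonic number. The geometric polynomials are $w_m(x)=\sum_{k=0}^{m}\left\{ {m \atop k}\right\} k!\,x^k$ (so $w_0(x)=1$), and the harmonic geometric polynomials are ${}_{H}w_m(x)=\sum_{k=1}^{m}\left\{ {m \atop k}\right\} k!\,H_k\,x^k$. -}

module Defs where

open import Data.Nat as ℕ using (ℕ; zero; suc; _!)
open import Data.Nat.Combinatorics using (_C_)
open import Data.Integer using (+_)
open import Data.Rational using (ℚ; _/_; _+_; _*_; 0ℚ; 1ℚ)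

⟦_⟧ : ℕ → ℚ
⟦ n ⟧ = + n / 1

_^_ : ℚ → ℕ → ℚ
x ^ zero  = 1ℚ
x ^ suc n = x * (x ^ n)

S : ℕ → ℕ → ℕ
S zero    zero    = 1
S zero    (suc k) = 0
S (suc n) zero    = 0
S (suc n) (suc k) = suc k ℕ.* S n (suc k) ℕ.+ S n k

-- Σ[k = a .. b] f k  (empty if b < a)
-- sumFrom a n f = f a + f (a+1) + ... + f (a+n-1)
sumFrom : ℕ → ℕ → (ℕ → ℚ) → ℚ
sumFrom a zero    f = 0ℚ
sumFrom a (suc n) f = f a + sumFrom (suc a) n f

Σ[_to_] : ℕ → ℕ → (ℕ → ℚ) → ℚ
Σ[ a to b ] f = sumFrom a (suc b ℕ.∸ a) f

H : ℕ → ℚ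
H k = sumFrom 0 k (λ i → + 1 / suc i)

w : ℕ → ℚ → ℚ
w m x = Σ[ 0 to m ] (λ k → ⟦ S m k ℕ.* k ! ⟧ * (x ^ k))

Hw : ℕ → ℚ → ℚ
Hw m x = Σ[ 1 to m ] (λ k → ⟦ S m k ℕ.* k ! ⟧ * H k * (x ^ k))

{-# OPTIONS --safe #-}
module Submission where

-- Write s(k,m) = S(m,k) k! for the number of surjections from an m-set onto a k-set, so that
-- w_m = Σ_k s(k,m) x^k. Splitting the domain of a surjection gives the binomial convolution
-- Σ_a C(m,a) s(j,a) s(i,m-a) = s(j+i,m); it follows by induction on m from
-- s(k,m+1) = k (s(k,m) + s(k-1,m)) and the Leibniz rule for binomial convolutions.
-- Writing H_k = Σ_{j<k} 1/(j+1) and k = (j+1) + i, this identity turns Hw_m into the binomial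
-- convolution Σ_a C(m,a) ℓ_a w_{m-a} with ℓ_a = Σ_k S(a,k) (k-1)! x^k. Since
-- s(k,a+1)/k = s(k,a) + s(k-1,a), we have ℓ_0 = 0 and ℓ_{a+1} = (1+x) w_a - [a = 0]; substituting,
-- the correction term contributes -m w_{m-1} and the term a = m contributes (1+x) w_{m-1}.

open import Defs
open import Data.Nat as ℕ using (ℕ; zero; suc; pred; _∸_; _≤_; _<_; z≤n; s≤s; _!)
import Data.Nat.Properties as ℕ
open import Data.Nat.Combinatorics using (_C_; nCk+nC[k+1]≡[n+1]C[k+1]; k>n⇒nCk≡0; nC1≡n; nCn≡1)
open import Data.Nat.Coprimality using (1-coprimeTo)
import Data.Nat.Coprimality as Coprime
import Data.Nat.Tactic.RingSolver as ℕ-Ring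
import Data.Integer as ℤ
import Data.Integer.Properties as ℤ
open import Data.Rational using (ℚ; mkℚ; _/_; _+_; _*_; _-_; 0ℚ; 1ℚ; _≟_)
import Data.Rational.Properties as ℚ
open import Data.Fin using (toℕ)
import Data.Fin.Properties as Fin
open import Function using (_∘_)
open import Level using (0ℓ)
open import Relation.Nullary.Decidable using (dec⇒maybe)
open import Relation.Binary.PropositionalEquality
open ≡-Reasoning

open import Algebra.Bundles using (CommutativeRing)
import Algebra.Properties.Semiring.Sum as SemiringSum
import Algebra.Properties.Group as GroupProperties
open import Algebra.Properties.Quasigroup (GroupProperties.quasigroup ℚ.+-0-group) using (x≈z//y)
open import Algebra.Properties.CommutativeSemigroup (CommutativeRing.+-commutativeSemigroup ℚ.+-*-commutativeRing)
  using (x∙yz≈y∙xz)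
open import Tactic.RingSolver using (solve-∀)
open import Tactic.RingSolver.Core.AlmostCommutativeRing using (AlmostCommutativeRing; fromCommutativeRing)

ℚ-ring : AlmostCommutativeRing 0ℓ 0ℓ
ℚ-ring = fromCommutativeRing ℚ.+-*-commutativeRing (λ p → dec⇒maybe (0ℚ ≟ p))

*-zero-* : ∀ p q → p * 0ℚ * q ≡ 0ℚ
*-zero-* p q = trans (cong (_* q) (ℚ.*-zeroʳ p)) (ℚ.*-zeroˡ q)

zero-*-* : ∀ p q → 0ℚ * p * q ≡ 0ℚ
zero-*-* p q = trans (cong (_* q) (ℚ.*-zeroˡ p)) (ℚ.*-zeroˡ q)

⟦⟧≡mkℚ : ∀ n → ⟦ n ⟧ ≡ mkℚ (ℤ.+ n) 0 (Coprime.sym (1-coprimeTo n))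
⟦⟧≡mkℚ n = ℚ.normalize-coprime (Coprime.sym (1-coprimeTo n))

⟦⟧-homo-+ : ∀ m n → ⟦ m ℕ.+ n ⟧ ≡ ⟦ m ⟧ + ⟦ n ⟧
⟦⟧-homo-+ m n rewrite ⟦⟧≡mkℚ m | ⟦⟧≡mkℚ n = cong (_/ 1) (begin
  ℤ.+ (m ℕ.+ n)                        ≡⟨ ℤ.pos-+ m n ⟩
  ℤ.+ m ℤ.+ ℤ.+ n                      ≡⟨ sym (cong₂ ℤ._+_ (ℤ.*-identityʳ (ℤ.+ m)) (ℤ.*-identityʳ (ℤ.+ n))) ⟩
  ℤ.+ m ℤ.* ℤ.+ 1 ℤ.+ ℤ.+ n ℤ.* ℤ.+ 1  ∎)

⟦⟧-homo-* : ∀ m n → ⟦ m ℕ.* n ⟧ ≡ ⟦ m ⟧ * ⟦ n ⟧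
⟦⟧-homo-* m n rewrite ⟦⟧≡mkℚ m | ⟦⟧≡mkℚ n = cong (_/ 1) (ℤ.pos-* m n)

1/suc : ℕ → ℚ
1/suc j = ℤ.+ 1 / suc j

1/suc*⟦suc⟧≡1 : ∀ j → 1/suc j * ⟦ suc j ⟧ ≡ 1ℚ
1/suc*⟦suc⟧≡1 j rewrite ⟦⟧≡mkℚ (suc j) | ℚ.normalize-coprime {1} {j} (1-coprimeTo (suc j)) =
  ℚ.*-inverseˡ (mkℚ (ℤ.+ suc j) 0 (Coprime.sym (1-coprimeTo (suc j))))

module FinSum = SemiringSum (CommutativeRing.semiring ℚ.+-*-commutativeRing)

-- Opaque, so that unification never unfolds a sum into the library's fold over Fin.
opaque
  sumℕ : ℕ → (ℕ → ℚ) → ℚ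
  sumℕ n f = FinSum.sum {n} (f ∘ toℕ)

  infixl 10 sumℕ
  syntax sumℕ n (λ i → e) = ∑[ i < n ] e

  ∑-cong : ∀ {n} {f g : ℕ → ℚ} → (∀ i → i < n → f i ≡ g i) → ∑[ i < n ] f i ≡ ∑[ i < n ] g i
  ∑-cong {n} f≗g = FinSum.sum-cong-≗ {n} (λ i → f≗g (toℕ i) (Fin.toℕ<n i))

  ∑-zero : ∀ {n} {f : ℕ → ℚ} → (∀ i → i < n → f i ≡ 0ℚ) → ∑[ i < n ] f i ≡ 0ℚ
  ∑-zero {n} f≗0 = trans (∑-cong f≗0) (FinSum.sum-replicate-zero n)

  ∑-+ : ∀ n (f g : ℕ → ℚ) → ∑[ i < n ] (f i + g i) ≡ ∑[ i < n ] f i + ∑[ i < n ] g i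
  ∑-+ n f g = FinSum.∑-distrib-+ {n} (f ∘ toℕ) (g ∘ toℕ)

  ∑-*ˡ : ∀ n c (f : ℕ → ℚ) → ∑[ i < n ] (c * f i) ≡ c * ∑[ i < n ] f i
  ∑-*ˡ n c f = sym (FinSum.*-distribˡ-sum {n} c (f ∘ toℕ))

  ∑-*ʳ : ∀ n c (f : ℕ → ℚ) → ∑[ i < n ] (f i * c) ≡ ∑[ i < n ] f i * c
  ∑-*ʳ n c f = sym (FinSum.*-distribʳ-sum {n} c (f ∘ toℕ))

  ∑-comm : ∀ m n (F : ℕ → ℕ → ℚ) → ∑[ i < m ] ∑[ j < n ] F i j ≡ ∑[ j < n ] ∑[ i < m ] F i j
  ∑-comm m n F = FinSum.∑-comm {m} {n} (λ i j → F (toℕ i) (toℕ j))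

  ∑-suc : ∀ n (f : ℕ → ℚ) → ∑[ i < suc n ] f i ≡ f 0 + ∑[ i < n ] f (suc i)
  ∑-suc n f = refl

  ∑-snoc : ∀ n (f : ℕ → ℚ) → ∑[ i < suc n ] f i ≡ ∑[ i < n ] f i + f n
  ∑-snoc n f = trans (FinSum.sum-init-last {n} (f ∘ toℕ))
    (cong₂ _+_ (FinSum.sum-cong-≗ {n} (cong f ∘ Fin.toℕ-inject₁)) (cong f (Fin.toℕ-fromℕ n)))

  ∑-empty : ∀ (f : ℕ → ℚ) → ∑[ i < 0 ] f i ≡ 0ℚ
  ∑-empty f = refl

∑-*-∑ : ∀ m n (f g : ℕ → ℚ) → (∑[ i < m ] f i) * (∑[ j < n ] g j) ≡ ∑[ i < m ] ∑[ j < n ] (f i * g j)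
∑-*-∑ m n f g = trans (sym (∑-*ʳ m (∑[ j < n ] g j) f)) (∑-cong (λ i _ → sym (∑-*ˡ n (f i) g)))

∑-pad : ∀ {n N} (f : ℕ → ℚ) → n ≤ N → (∀ i → n ≤ i → f i ≡ 0ℚ) →
        ∑[ i < n ] f i ≡ ∑[ i < N ] f i
∑-pad f z≤n               f≗0 = trans (∑-empty f) (sym (∑-zero (λ i _ → f≗0 i z≤n)))
∑-pad f (s≤s {n} {N} n≤N) f≗0 = begin
  ∑[ i < suc n ] f i          ≡⟨ ∑-suc n f ⟩
  f 0 + ∑[ i < n ] f (suc i)  ≡⟨ cong (f 0 +_) (∑-pad (f ∘ suc) n≤N (λ i → f≗0 (suc i) ∘ s≤s)) ⟩
  f 0 + ∑[ i < N ] f (suc i)  ≡⟨ sym (∑-suc N f) ⟩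
  ∑[ i < suc N ] f i          ∎

∑-triangle : ∀ n (F : ℕ → ℕ → ℚ) →
             ∑[ k < n ] ∑[ j < suc k ] F j k ≡ ∑[ j < n ] ∑[ i < n ∸ j ] F j (j ℕ.+ i)
∑-triangle zero    F = trans (∑-empty _) (sym (∑-empty _))
∑-triangle (suc n) F = begin
  ∑[ k < suc n ] ∑[ j < suc k ] F j k
    ≡⟨ ∑-snoc n (λ k → ∑[ j < suc k ] F j k) ⟩
  ∑[ k < n ] ∑[ j < suc k ] F j k + ∑[ j < suc n ] F j n
    ≡⟨ cong (_+ R) (∑-triangle n F) ⟩
  ∑[ j < n ] ∑[ i < n ∸ j ] F j (j ℕ.+ i) + ∑[ j < suc n ] F j n
    ≡⟨ cong (_+ R) (∑-pad (λ j → ∑[ i < n ∸ j ] F j (j ℕ.+ i)) (ℕ.n≤1+n n) empty-row) ⟩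
  ∑[ j < suc n ] ∑[ i < n ∸ j ] F j (j ℕ.+ i) + ∑[ j < suc n ] F j n
    ≡⟨ sym (∑-+ (suc n) (λ j → ∑[ i < n ∸ j ] F j (j ℕ.+ i)) (λ j → F j n)) ⟩
  ∑[ j < suc n ] (∑[ i < n ∸ j ] F j (j ℕ.+ i) + F j n)
    ≡⟨ ∑-cong (λ j j<1+n → sym (last-row j (ℕ.s≤s⁻¹ j<1+n))) ⟩
  ∑[ j < suc n ] ∑[ i < suc n ∸ j ] F j (j ℕ.+ i) ∎
  where
  R = ∑[ j < suc n ] F j n
  empty-row : ∀ j → n ≤ j → ∑[ i < n ∸ j ] F j (j ℕ.+ i) ≡ 0ℚ
  empty-row j n≤j = trans (cong (λ t → ∑[ i < t ] F j (j ℕ.+ i)) (ℕ.m≤n⇒m∸n≡0 n≤j))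
                          (∑-empty (λ i → F j (j ℕ.+ i)))
  last-row : ∀ j → j ≤ n → ∑[ i < suc n ∸ j ] F j (j ℕ.+ i) ≡ ∑[ i < n ∸ j ] F j (j ℕ.+ i) + F j n
  last-row j j≤n = begin
    ∑[ i < suc n ∸ j ] F j (j ℕ.+ i)
      ≡⟨ cong (λ t → ∑[ i < t ] F j (j ℕ.+ i)) (ℕ.+-∸-assoc 1 j≤n) ⟩
    ∑[ i < suc (n ∸ j) ] F j (j ℕ.+ i)
      ≡⟨ ∑-snoc (n ∸ j) (λ i → F j (j ℕ.+ i)) ⟩
    ∑[ i < n ∸ j ] F j (j ℕ.+ i) + F j (j ℕ.+ (n ∸ j))
      ≡⟨ cong (λ t → ∑[ i < n ∸ j ] F j (j ℕ.+ i) + F j t) (ℕ.m+[n∸m]≡n j≤n) ⟩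
    ∑[ i < n ∸ j ] F j (j ℕ.+ i) + F j n ∎

sumFrom≡∑ : ∀ a n (f : ℕ → ℚ) → sumFrom a n f ≡ ∑[ i < n ] f (a ℕ.+ i)
sumFrom≡∑ a zero    f = sym (∑-empty _)
sumFrom≡∑ a (suc n) f = begin
  f a + sumFrom (suc a) n f
    ≡⟨ cong (f a +_) (sumFrom≡∑ (suc a) n f) ⟩
  f a + ∑[ i < n ] f (suc a ℕ.+ i)
    ≡⟨ cong₂ _+_ (cong f (sym (ℕ.+-identityʳ a))) (∑-cong (λ i _ → cong f (sym (ℕ.+-suc a i)))) ⟩
  f (a ℕ.+ 0) + ∑[ i < n ] f (a ℕ.+ suc i)
    ≡⟨ sym (∑-suc n (λ i → f (a ℕ.+ i))) ⟩
  ∑[ i < suc n ] f (a ℕ.+ i) ∎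

∑-linear : ∀ n c (f g : ℕ → ℚ) → ∑[ i < n ] (c * (f i + g i)) ≡ c * (∑[ i < n ] f i + ∑[ i < n ] g i)
∑-linear n c f g = trans (∑-*ˡ n c _) (cong (c *_) (∑-+ n f g))

infixl 7 _⊛_

_⊛_ : (ℕ → ℚ) → (ℕ → ℚ) → ℕ → ℚ
(F ⊛ G) m = ∑[ a < suc m ] (⟦ m C a ⟧ * F a * G (m ∸ a))

⊛-linearˡ : ∀ F c F₁ F₂ G m → (∀ a → F a ≡ c * (F₁ a + F₂ a)) →
            (F ⊛ G) m ≡ c * ((F₁ ⊛ G) m + (F₂ ⊛ G) m)
⊛-linearˡ F c F₁ F₂ G m F≗ = trans (∑-cong (λ a _ → step a)) (∑-linear (suc m) c _ _)
  where
  distrib : ∀ b c f₁ f₂ g → b * (c * (f₁ + f₂)) * g ≡ c * (b * f₁ * g + b * f₂ * g)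
  distrib = solve-∀ ℚ-ring
  step : ∀ a → ⟦ m C a ⟧ * F a * G (m ∸ a)
             ≡ c * (⟦ m C a ⟧ * F₁ a * G (m ∸ a) + ⟦ m C a ⟧ * F₂ a * G (m ∸ a))
  step a = trans (cong (λ p → ⟦ m C a ⟧ * p * G (m ∸ a)) (F≗ a))
                 (distrib ⟦ m C a ⟧ c (F₁ a) (F₂ a) (G (m ∸ a)))

⊛-linearʳ : ∀ F G c G₁ G₂ m → (∀ a → G a ≡ c * (G₁ a + G₂ a)) →
            (F ⊛ G) m ≡ c * ((F ⊛ G₁) m + (F ⊛ G₂) m)
⊛-linearʳ F G c G₁ G₂ m G≗ = trans (∑-cong (λ a _ → step a)) (∑-linear (suc m) c _ _)
  where
  distrib : ∀ b c f g₁ g₂ → b * f * (c * (g₁ + g₂)) ≡ c * (b * f * g₁ + b * f * g₂)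
  distrib = solve-∀ ℚ-ring
  step : ∀ a → ⟦ m C a ⟧ * F a * G (m ∸ a)
             ≡ c * (⟦ m C a ⟧ * F a * G₁ (m ∸ a) + ⟦ m C a ⟧ * F a * G₂ (m ∸ a))
  step a = trans (cong (⟦ m C a ⟧ * F a *_) (G≗ (m ∸ a)))
                 (distrib ⟦ m C a ⟧ c (F a) (G₁ (m ∸ a)) (G₂ (m ∸ a)))

⊛-zero : ∀ F G → (F ⊛ G) 0 ≡ F 0 * G 0
⊛-zero F G = begin
  (F ⊛ G) 0
    ≡⟨ ∑-suc 0 (λ a → ⟦ 0 C a ⟧ * F a * G (0 ∸ a)) ⟩
  1ℚ * F 0 * G 0 + ∑[ a < 0 ] (⟦ 0 C suc a ⟧ * F (suc a) * G 0)
    ≡⟨ cong (1ℚ * F 0 * G 0 +_) (∑-empty (λ a → ⟦ 0 C suc a ⟧ * F (suc a) * G 0)) ⟩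
  1ℚ * F 0 * G 0 + 0ℚ
    ≡⟨ trans (ℚ.+-identityʳ (1ℚ * F 0 * G 0)) (cong (_* G 0) (ℚ.*-identityˡ (F 0))) ⟩
  F 0 * G 0 ∎

⊛-suc : ∀ F G m → (F ⊛ G) (suc m) ≡ ((F ∘ suc) ⊛ G) m + (F ⊛ (G ∘ suc)) m
⊛-suc F G m = begin
  (F ⊛ G) (suc m)
    ≡⟨ ∑-suc (suc m) (λ a → ⟦ suc m C a ⟧ * F a * G (suc m ∸ a)) ⟩
  t₀ + ∑[ a < suc m ] (⟦ suc m C suc a ⟧ * F (suc a) * G (m ∸ a))
    ≡⟨ cong (t₀ +_) (trans (∑-cong (λ a _ → pascal a)) (∑-+ (suc m) _ u)) ⟩
  t₀ + (((F ∘ suc) ⊛ G) m + ∑[ a < suc m ] u a)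
    ≡⟨ cong (λ s → t₀ + (((F ∘ suc) ⊛ G) m + s)) (sym (∑-pad u (ℕ.n≤1+n m) u-vanish)) ⟩
  t₀ + (((F ∘ suc) ⊛ G) m + ∑[ a < m ] u a)
    ≡⟨ x∙yz≈y∙xz t₀ (((F ∘ suc) ⊛ G) m) (∑[ a < m ] u a) ⟩
  ((F ∘ suc) ⊛ G) m + (t₀ + ∑[ a < m ] u a)
    ≡⟨ cong (λ s → ((F ∘ suc) ⊛ G) m + (t₀ + s)) (∑-cong u-shift) ⟩
  ((F ∘ suc) ⊛ G) m + (t₀ + ∑[ a < m ] (⟦ m C suc a ⟧ * F (suc a) * G (suc (m ∸ suc a))))
    ≡⟨ cong (((F ∘ suc) ⊛ G) m +_) (sym (∑-suc m (λ a → ⟦ m C a ⟧ * F a * G (suc (m ∸ a))))) ⟩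
  ((F ∘ suc) ⊛ G) m + (F ⊛ (G ∘ suc)) m ∎
  where
  t₀ = ⟦ m C 0 ⟧ * F 0 * G (suc m)
  u : ℕ → ℚ
  u a = ⟦ m C suc a ⟧ * F (suc a) * G (m ∸ a)
  distrib : ∀ c d f g → (c + d) * f * g ≡ c * f * g + d * f * g
  distrib = solve-∀ ℚ-ring
  pascal : ∀ a → ⟦ suc m C suc a ⟧ * F (suc a) * G (m ∸ a) ≡ ⟦ m C a ⟧ * F (suc a) * G (m ∸ a) + u a
  pascal a = begin
    ⟦ suc m C suc a ⟧ * F (suc a) * G (m ∸ a)
      ≡⟨ cong (λ c → ⟦ c ⟧ * F (suc a) * G (m ∸ a)) (sym (nCk+nC[k+1]≡[n+1]C[k+1] m a)) ⟩
    ⟦ m C a ℕ.+ m C suc a ⟧ * F (suc a) * G (m ∸ a)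
      ≡⟨ cong (λ c → c * F (suc a) * G (m ∸ a)) (⟦⟧-homo-+ (m C a) (m C suc a)) ⟩
    (⟦ m C a ⟧ + ⟦ m C suc a ⟧) * F (suc a) * G (m ∸ a)
      ≡⟨ distrib ⟦ m C a ⟧ ⟦ m C suc a ⟧ (F (suc a)) (G (m ∸ a)) ⟩
    ⟦ m C a ⟧ * F (suc a) * G (m ∸ a) + u a ∎
  u-vanish : ∀ a → m ≤ a → u a ≡ 0ℚ
  u-vanish a m≤a = trans (cong (λ c → ⟦ c ⟧ * F (suc a) * G (m ∸ a)) (k>n⇒nCk≡0 (s≤s m≤a)))
                         (zero-*-* (F (suc a)) (G (m ∸ a)))
  u-shift : ∀ a → a < m → u a ≡ ⟦ m C suc a ⟧ * F (suc a) * G (suc (m ∸ suc a))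
  u-shift a a<m = cong (λ k → ⟦ m C suc a ⟧ * F (suc a) * G k) (ℕ.+-∸-assoc 1 a<m)

S-vanish : ∀ {m k} → m < k → S m k ≡ 0
S-vanish {zero}  {suc k} _ = refl
S-vanish {suc m} {suc k} (s≤s m<k) = begin
  suc k ℕ.* S m (suc k) ℕ.+ S m k
    ≡⟨ cong₂ (λ p q → suc k ℕ.* p ℕ.+ q) (S-vanish (ℕ.m<n⇒m<1+n m<k)) (S-vanish m<k) ⟩
  suc k ℕ.* 0 ℕ.+ 0
    ≡⟨ trans (ℕ.+-identityʳ (suc k ℕ.* 0)) (ℕ.*-zeroʳ (suc k)) ⟩
  0 ∎

surj : ℕ → ℕ → ℚ
surj k m = ⟦ S m k ℕ.* k ! ⟧

surj-vanish : ∀ {m k} → m < k → surj k m ≡ 0ℚ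
surj-vanish {m} {k} m<k = cong (λ s → ⟦ s ℕ.* k ! ⟧) (S-vanish m<k)

surj-suc : ∀ k m → surj k (suc m) ≡ ⟦ k ⟧ * (surj k m + surj (pred k) m)
surj-suc zero    m = sym (ℚ.*-zeroˡ (surj 0 m + surj 0 m))
surj-suc (suc k) m = begin
  ⟦ (suc k ℕ.* S m (suc k) ℕ.+ S m k) ℕ.* (suc k ℕ.* k !) ⟧
    ≡⟨ cong ⟦_⟧ (rearrange (suc k) (S m (suc k)) (S m k) (k !)) ⟩
  ⟦ suc k ℕ.* (S m (suc k) ℕ.* (suc k ℕ.* k !) ℕ.+ S m k ℕ.* k !) ⟧
    ≡⟨ ⟦⟧-homo-* (suc k) (S m (suc k) ℕ.* (suc k ℕ.* k !) ℕ.+ S m k ℕ.* k !) ⟩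
  ⟦ suc k ⟧ * ⟦ S m (suc k) ℕ.* (suc k ℕ.* k !) ℕ.+ S m k ℕ.* k ! ⟧
    ≡⟨ cong (⟦ suc k ⟧ *_) (⟦⟧-homo-+ (S m (suc k) ℕ.* (suc k ℕ.* k !)) (S m k ℕ.* k !)) ⟩
  ⟦ suc k ⟧ * (surj (suc k) m + surj k m) ∎
  where
  rearrange : ∀ s a b f → (s ℕ.* a ℕ.+ b) ℕ.* (s ℕ.* f) ≡ s ℕ.* (a ℕ.* (s ℕ.* f) ℕ.+ b ℕ.* f)
  rearrange = ℕ-Ring.solve-∀

pred-weightˡ : ∀ (f : ℕ → ℚ) j i → ⟦ j ⟧ * f (pred j ℕ.+ i) ≡ ⟦ j ⟧ * f (pred (j ℕ.+ i))
pred-weightˡ f zero    i = trans (ℚ.*-zeroˡ (f i)) (sym (ℚ.*-zeroˡ (f (pred i))))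
pred-weightˡ f (suc j) i = refl

pred-weightʳ : ∀ (f : ℕ → ℚ) j i → ⟦ i ⟧ * f (j ℕ.+ pred i) ≡ ⟦ i ⟧ * f (pred (j ℕ.+ i))
pred-weightʳ f j zero    = trans (ℚ.*-zeroˡ (f (j ℕ.+ 0))) (sym (ℚ.*-zeroˡ (f (pred (j ℕ.+ 0)))))
pred-weightʳ f j (suc i) = cong (λ k → ⟦ suc i ⟧ * f (pred k)) (sym (ℕ.+-suc j i))

surj-⊛ : ∀ j i m → (surj j ⊛ surj i) m ≡ surj (j ℕ.+ i) m
surj-⊛ j i zero = trans (⊛-zero (surj j) (surj i)) (base j i)
  where
  base : ∀ j i → surj j 0 * surj i 0 ≡ surj (j ℕ.+ i) 0
  base zero    zero    = refl
  base zero    (suc i) = refl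
  base (suc j) zero    = refl
  base (suc j) (suc i) = refl
surj-⊛ j i (suc m) = begin
  (surj j ⊛ surj i) (suc m)
    ≡⟨ ⊛-suc (surj j) (surj i) m ⟩
  ((surj j ∘ suc) ⊛ surj i) m + (surj j ⊛ (surj i ∘ suc)) m
    ≡⟨ cong₂ _+_ (⊛-linearˡ (surj j ∘ suc) ⟦ j ⟧ (surj j) (surj (pred j)) (surj i) m (surj-suc j))
                 (⊛-linearʳ (surj j) (surj i ∘ suc) ⟦ i ⟧ (surj i) (surj (pred i)) m (surj-suc i)) ⟩
  ⟦ j ⟧ * ((surj j ⊛ surj i) m + (surj (pred j) ⊛ surj i) m)
    + ⟦ i ⟧ * ((surj j ⊛ surj i) m + (surj j ⊛ surj (pred i)) m)
    ≡⟨ cong₂ _+_ (cong (⟦ j ⟧ *_) (cong₂ _+_ (surj-⊛ j i m) (surj-⊛ (pred j) i m)))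
                 (cong (⟦ i ⟧ *_) (cong₂ _+_ (surj-⊛ j i m) (surj-⊛ j (pred i) m))) ⟩
  ⟦ j ⟧ * (surj (j ℕ.+ i) m + surj (pred j ℕ.+ i) m)
    + ⟦ i ⟧ * (surj (j ℕ.+ i) m + surj (j ℕ.+ pred i) m)
    ≡⟨ cong₂ _+_ (pred-weightˡ (λ k → surj (j ℕ.+ i) m + surj k m) j i)
                 (pred-weightʳ (λ k → surj (j ℕ.+ i) m + surj k m) j i) ⟩
  ⟦ j ⟧ * T + ⟦ i ⟧ * T
    ≡⟨ sym (ℚ.*-distribʳ-+ T ⟦ j ⟧ ⟦ i ⟧) ⟩
  (⟦ j ⟧ + ⟦ i ⟧) * T
    ≡⟨ cong (_* T) (sym (⟦⟧-homo-+ j i)) ⟩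
  ⟦ j ℕ.+ i ⟧ * T
    ≡⟨ sym (surj-suc (j ℕ.+ i) m) ⟩
  surj (j ℕ.+ i) (suc m) ∎
  where
  T = surj (j ℕ.+ i) m + surj (pred (j ℕ.+ i)) m

^-+ : ∀ x j i → x ^ (j ℕ.+ i) ≡ x ^ j * x ^ i
^-+ x zero    i = sym (ℚ.*-identityˡ (x ^ i))
^-+ x (suc j) i = trans (cong (x *_) (^-+ x j i)) (sym (ℚ.*-assoc x (x ^ j) (x ^ i)))

module _ (x : ℚ) where

  term : ℕ → ℕ → ℚ
  term m k = surj k m * x ^ k

  ℓ : ℕ → ℚ
  ℓ a = ∑[ j < a ] (1/suc j * term a (suc j))

  ℓ⊛w : ℕ → ℚ
  ℓ⊛w = ℓ ⊛ (λ b → w b x)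

  w≡∑ : ∀ m → w m x ≡ ∑[ k < suc m ] term m k
  w≡∑ m = sumFrom≡∑ 0 (suc m) (term m)

  term-vanish : ∀ {m k} → m < k → term m k ≡ 0ℚ
  term-vanish {m} {k} m<k = trans (cong (_* x ^ k) (surj-vanish m<k)) (ℚ.*-zeroˡ (x ^ k))

  w-padded : ∀ {b N} → b < N → w b x ≡ ∑[ i < N ] term b i
  w-padded {b} b<N = trans (w≡∑ b) (∑-pad (term b) b<N (λ _ → term-vanish))

  ℓ-padded : ∀ {a N} → a ≤ N → ℓ a ≡ ∑[ j < N ] (1/suc j * term a (suc j))
  ℓ-padded {a} a≤N = ∑-pad (λ j → 1/suc j * term a (suc j)) a≤N
    (λ j a≤j → trans (cong (1/suc j *_) (term-vanish (s≤s a≤j))) (ℚ.*-zeroʳ (1/suc j)))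

  Hw≡∑∑ : ∀ m → Hw m x ≡ ∑[ j < suc m ] ∑[ i < suc m ] (1/suc j * term m (suc (j ℕ.+ i)))
  Hw≡∑∑ m = begin
    Hw m x
      ≡⟨ sumFrom≡∑ 1 m (λ k → surj k m * H k * x ^ k) ⟩
    ∑[ k < m ] (surj (suc k) m * H (suc k) * x ^ suc k)
      ≡⟨ ∑-cong (λ k _ → expand-H k) ⟩
    ∑[ k < m ] ∑[ j < suc k ] (1/suc j * term m (suc k))
      ≡⟨ ∑-triangle m (λ j k → 1/suc j * term m (suc k)) ⟩
    ∑[ j < m ] ∑[ i < m ∸ j ] (1/suc j * term m (suc (j ℕ.+ i)))
      ≡⟨ ∑-pad (λ j → ∑[ i < m ∸ j ] (1/suc j * term m (suc (j ℕ.+ i)))) (ℕ.n≤1+n m) empty-row ⟩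
    ∑[ j < suc m ] ∑[ i < m ∸ j ] (1/suc j * term m (suc (j ℕ.+ i)))
      ≡⟨ ∑-cong (λ j _ → ∑-pad (λ i → 1/suc j * term m (suc (j ℕ.+ i))) (ℕ.m≤n⇒m≤1+n (ℕ.m∸n≤m m j))
                                (λ i m∸j≤i → trans (cong (1/suc j *_) (term-vanish (s≤s (m≤j+i m∸j≤i))))
                                                   (ℚ.*-zeroʳ (1/suc j)))) ⟩
    ∑[ j < suc m ] ∑[ i < suc m ] (1/suc j * term m (suc (j ℕ.+ i))) ∎
    where
    regroup : ∀ s h y → s * h * y ≡ h * (s * y)
    regroup = solve-∀ ℚ-ring
    expand-H : ∀ k → surj (suc k) m * H (suc k) * x ^ suc k ≡ ∑[ j < suc k ] (1/suc j * term m (suc k))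
    expand-H k = begin
      surj (suc k) m * H (suc k) * x ^ suc k  ≡⟨ regroup (surj (suc k) m) (H (suc k)) (x ^ suc k) ⟩
      H (suc k) * term m (suc k)              ≡⟨ cong (_* term m (suc k)) (sumFrom≡∑ 0 (suc k) 1/suc) ⟩
      (∑[ j < suc k ] 1/suc j) * term m (suc k) ≡⟨ sym (∑-*ʳ (suc k) (term m (suc k)) 1/suc) ⟩
      ∑[ j < suc k ] (1/suc j * term m (suc k)) ∎
    empty-row : ∀ j → m ≤ j → ∑[ i < m ∸ j ] (1/suc j * term m (suc (j ℕ.+ i))) ≡ 0ℚ
    empty-row j m≤j = trans (cong (λ t → ∑[ i < t ] (1/suc j * term m (suc (j ℕ.+ i)))) (ℕ.m≤n⇒m∸n≡0 m≤j))
                            (∑-empty (λ i → 1/suc j * term m (suc (j ℕ.+ i))))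
    m≤j+i : ∀ {j i} → m ∸ j ≤ i → m ≤ j ℕ.+ i
    m≤j+i {j} m∸j≤i = ℕ.≤-trans (ℕ.m≤n+m∸n m j) (ℕ.+-monoʳ-≤ j m∸j≤i)

  ℓ⊛w≡∑∑ : ∀ m → ℓ⊛w m ≡ ∑[ j < suc m ] ∑[ i < suc m ] (1/suc j * term m (suc (j ℕ.+ i)))
  ℓ⊛w≡∑∑ m = begin
    ∑[ a < N ] (⟦ m C a ⟧ * ℓ a * w (m ∸ a) x)
      ≡⟨ ∑-cong (λ a a<N → cong₂ (λ p q → ⟦ m C a ⟧ * p * q)
                                  (ℓ-padded (ℕ.<⇒≤ a<N)) (w-padded (s≤s (ℕ.m∸n≤m m a)))) ⟩
    ∑[ a < N ] (⟦ m C a ⟧ * (∑[ j < N ] L a j) * (∑[ i < N ] term (m ∸ a) i))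
      ≡⟨ ∑-cong (λ a _ → trans (cong (_* (∑[ i < N ] term (m ∸ a) i)) (sym (∑-*ˡ N ⟦ m C a ⟧ (L a))))
                                (∑-*-∑ N N (λ j → ⟦ m C a ⟧ * L a j) (term (m ∸ a)))) ⟩
    ∑[ a < N ] ∑[ j < N ] ∑[ i < N ] (⟦ m C a ⟧ * L a j * term (m ∸ a) i)
      ≡⟨ ∑-comm N N (λ a j → ∑[ i < N ] (⟦ m C a ⟧ * L a j * term (m ∸ a) i)) ⟩
    ∑[ j < N ] ∑[ a < N ] ∑[ i < N ] (⟦ m C a ⟧ * L a j * term (m ∸ a) i)
      ≡⟨ ∑-cong (λ j _ → ∑-comm N N (λ a i → ⟦ m C a ⟧ * L a j * term (m ∸ a) i)) ⟩
    ∑[ j < N ] ∑[ i < N ] ∑[ a < N ] (⟦ m C a ⟧ * L a j * term (m ∸ a) i)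
      ≡⟨ ∑-cong (λ j _ → ∑-cong (λ i _ → collect j i)) ⟩
    ∑[ j < N ] ∑[ i < N ] (1/suc j * term m (suc (j ℕ.+ i))) ∎
    where
    N = suc m
    L : ℕ → ℕ → ℚ
    L a j = 1/suc j * term a (suc j)
    regroup : ∀ b c s X t Y → b * (c * (s * X)) * (t * Y) ≡ c * (X * Y) * (b * s * t)
    regroup = solve-∀ ℚ-ring
    collect : ∀ j i → ∑[ a < N ] (⟦ m C a ⟧ * L a j * term (m ∸ a) i) ≡ 1/suc j * term m (suc (j ℕ.+ i))
    collect j i = begin
      ∑[ a < N ] (⟦ m C a ⟧ * L a j * term (m ∸ a) i)
        ≡⟨ ∑-cong (λ a _ → regroup ⟦ m C a ⟧ (1/suc j) (surj (suc j) a) (x ^ suc j) (surj i (m ∸ a)) (x ^ i)) ⟩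
      ∑[ a < N ] (c * (⟦ m C a ⟧ * surj (suc j) a * surj i (m ∸ a)))
        ≡⟨ ∑-*ˡ N c (λ a → ⟦ m C a ⟧ * surj (suc j) a * surj i (m ∸ a)) ⟩
      c * (surj (suc j) ⊛ surj i) m
        ≡⟨ cong₂ (λ p q → 1/suc j * p * q) (sym (^-+ x (suc j) i)) (surj-⊛ (suc j) i m) ⟩
      1/suc j * x ^ suc (j ℕ.+ i) * surj (suc (j ℕ.+ i)) m
        ≡⟨ trans (ℚ.*-assoc (1/suc j) _ _) (cong (1/suc j *_) (ℚ.*-comm (x ^ suc (j ℕ.+ i)) _)) ⟩
      1/suc j * term m (suc (j ℕ.+ i)) ∎
      where
      c = 1/suc j * (x ^ suc j * x ^ i)

  Hw≡ℓ⊛w : ∀ m → Hw m x ≡ ℓ⊛w m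
  Hw≡ℓ⊛w m = trans (Hw≡∑∑ m) (sym (ℓ⊛w≡∑∑ m))

  ℓ-suc : ∀ b → ℓ (suc b) + surj 0 b ≡ (1ℚ + x) * w b x
  ℓ-suc b = begin
    ℓ (suc b) + surj 0 b
      ≡⟨ cong (_+ surj 0 b) (∑-cong (λ j _ → split j)) ⟩
    ∑[ j < suc b ] (term b (suc j) + x * term b j) + surj 0 b
      ≡⟨ cong (_+ surj 0 b) (∑-+ (suc b) (term b ∘ suc) (λ j → x * term b j)) ⟩
    (∑[ j < suc b ] term b (suc j) + ∑[ j < suc b ] (x * term b j)) + surj 0 b
      ≡⟨ cong (_+ surj 0 b) (cong₂ _+_ (sym (∑-pad (term b ∘ suc) (ℕ.n≤1+n b) (λ j → term-vanish ∘ s≤s)))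
                                       (∑-*ˡ (suc b) x (term b))) ⟩
    (A + x * ∑[ j < suc b ] term b j) + surj 0 b
      ≡⟨ cong (λ t → (A + x * t) + surj 0 b) (∑-suc b (term b)) ⟩
    (A + x * (surj 0 b * 1ℚ + A)) + surj 0 b
      ≡⟨ regroup (surj 0 b) A x ⟩
    (1ℚ + x) * (surj 0 b * 1ℚ + A)
      ≡⟨ cong ((1ℚ + x) *_) (sym (trans (w≡∑ b) (∑-suc b (term b)))) ⟩
    (1ℚ + x) * w b x ∎
    where
    A = ∑[ j < b ] term b (suc j)
    regroup : ∀ s A y → (A + y * (s * 1ℚ + A)) + s ≡ (1ℚ + y) * (s * 1ℚ + A)
    regroup = solve-∀ ℚ-ring
    distrib : ∀ c n s t y z → c * (n * (s + t) * (y * z)) ≡ (c * n) * (s * (y * z) + y * (t * z))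
    distrib = solve-∀ ℚ-ring
    split : ∀ j → 1/suc j * term (suc b) (suc j) ≡ term b (suc j) + x * term b j
    split j = begin
      1/suc j * (surj (suc j) (suc b) * x ^ suc j)
        ≡⟨ cong (λ s → 1/suc j * (s * x ^ suc j)) (surj-suc (suc j) b) ⟩
      1/suc j * (⟦ suc j ⟧ * (surj (suc j) b + surj j b) * (x * x ^ j))
        ≡⟨ distrib (1/suc j) ⟦ suc j ⟧ (surj (suc j) b) (surj j b) x (x ^ j) ⟩
      (1/suc j * ⟦ suc j ⟧) * (term b (suc j) + x * term b j)
        ≡⟨ cong (_* (term b (suc j) + x * term b j)) (1/suc*⟦suc⟧≡1 j) ⟩
      1ℚ * (term b (suc j) + x * term b j)
        ≡⟨ ℚ.*-identityˡ (term b (suc j) + x * term b j) ⟩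
      term b (suc j) + x * term b j ∎

  ∑-surj₀ : ∀ n → ∑[ a < suc n ] (⟦ suc n C suc a ⟧ * surj 0 a * w (n ∸ a) x) ≡ ⟦ suc n ⟧ * w n x
  ∑-surj₀ n = begin
    ∑[ a < suc n ] (⟦ suc n C suc a ⟧ * surj 0 a * w (n ∸ a) x)
      ≡⟨ ∑-suc n (λ a → ⟦ suc n C suc a ⟧ * surj 0 a * w (n ∸ a) x) ⟩
    ⟦ suc n C 1 ⟧ * 1ℚ * w n x + ∑[ a < n ] (⟦ suc n C suc (suc a) ⟧ * 0ℚ * w (n ∸ suc a) x)
      ≡⟨ cong₂ _+_ (cong (λ k → ⟦ k ⟧ * 1ℚ * w n x) (nC1≡n (suc n)))
                   (∑-zero (λ a _ → *-zero-* ⟦ suc n C suc (suc a) ⟧ (w (n ∸ suc a) x))) ⟩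
    ⟦ suc n ⟧ * 1ℚ * w n x + 0ℚ
      ≡⟨ trans (ℚ.+-identityʳ _) (cong (_* w n x) (ℚ.*-identityʳ ⟦ suc n ⟧)) ⟩
    ⟦ suc n ⟧ * w n x ∎

  ℓ⊛w-suc : ∀ n → ℓ⊛w (suc n) + ⟦ suc n ⟧ * w n x
                ≡ (1ℚ + x) * ∑[ a < suc n ] (⟦ suc n C suc a ⟧ * w a x * w (n ∸ a) x)
  ℓ⊛w-suc n = begin
    ℓ⊛w (suc n) + ⟦ suc n ⟧ * w n x
      ≡⟨ cong₂ _+_ (∑-suc (suc n) (λ a → ⟦ suc n C a ⟧ * ℓ a * w (suc n ∸ a) x)) (sym (∑-surj₀ n)) ⟩
    (⟦ suc n C 0 ⟧ * ℓ 0 * w (suc n) x + ∑[ a < suc n ] P a) + ∑[ a < suc n ] Q a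
      ≡⟨ cong (λ t → (t + ∑[ a < suc n ] P a) + ∑[ a < suc n ] Q a) ℓ₀-term ⟩
    (0ℚ + ∑[ a < suc n ] P a) + ∑[ a < suc n ] Q a
      ≡⟨ cong (_+ ∑[ a < suc n ] Q a) (ℚ.+-identityˡ (∑[ a < suc n ] P a)) ⟩
    ∑[ a < suc n ] P a + ∑[ a < suc n ] Q a
      ≡⟨ sym (∑-+ (suc n) P Q) ⟩
    ∑[ a < suc n ] (P a + Q a)
      ≡⟨ ∑-cong (λ a _ → combine a) ⟩
    ∑[ a < suc n ] ((1ℚ + x) * (⟦ suc n C suc a ⟧ * w a x * w (n ∸ a) x))
      ≡⟨ ∑-*ˡ (suc n) (1ℚ + x) (λ a → ⟦ suc n C suc a ⟧ * w a x * w (n ∸ a) x) ⟩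
    (1ℚ + x) * ∑[ a < suc n ] (⟦ suc n C suc a ⟧ * w a x * w (n ∸ a) x) ∎
    where
    P Q : ℕ → ℚ
    P a = ⟦ suc n C suc a ⟧ * ℓ (suc a) * w (n ∸ a) x
    Q a = ⟦ suc n C suc a ⟧ * surj 0 a * w (n ∸ a) x
    ℓ₀-term : ⟦ suc n C 0 ⟧ * ℓ 0 * w (suc n) x ≡ 0ℚ
    ℓ₀-term = trans (cong (λ l → ⟦ suc n C 0 ⟧ * l * w (suc n) x) (∑-empty (λ j → 1/suc j * term 0 (suc j))))
                    (*-zero-* ⟦ suc n C 0 ⟧ (w (suc n) x))
    factor : ∀ b l s v → b * l * v + b * s * v ≡ b * (l + s) * v
    factor = solve-∀ ℚ-ring
    regroup : ∀ b y u v → b * (y * u) * v ≡ y * (b * u * v)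
    regroup = solve-∀ ℚ-ring
    combine : ∀ a → P a + Q a ≡ (1ℚ + x) * (⟦ suc n C suc a ⟧ * w a x * w (n ∸ a) x)
    combine a = begin
      P a + Q a
        ≡⟨ factor ⟦ suc n C suc a ⟧ (ℓ (suc a)) (surj 0 a) (w (n ∸ a) x) ⟩
      ⟦ suc n C suc a ⟧ * (ℓ (suc a) + surj 0 a) * w (n ∸ a) x
        ≡⟨ cong (λ t → ⟦ suc n C suc a ⟧ * t * w (n ∸ a) x) (ℓ-suc a) ⟩
      ⟦ suc n C suc a ⟧ * ((1ℚ + x) * w a x) * w (n ∸ a) x
        ≡⟨ regroup ⟦ suc n C suc a ⟧ (1ℚ + x) (w a x) (w (n ∸ a) x) ⟩
      (1ℚ + x) * (⟦ suc n C suc a ⟧ * w a x * w (n ∸ a) x) ∎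

  ∑-binomial-w : ∀ n → ∑[ a < suc n ] (⟦ suc n C suc a ⟧ * w a x * w (n ∸ a) x)
                       ≡ Σ[ 1 to n ] (λ k → ⟦ suc n C k ⟧ * w (k ∸ 1) x * w (suc n ∸ k) x) + w n x
  ∑-binomial-w n = begin
    ∑[ a < suc n ] P a
      ≡⟨ ∑-snoc n P ⟩
    ∑[ a < n ] P a + ⟦ suc n C suc n ⟧ * w n x * w (n ∸ n) x
      ≡⟨ cong₂ _+_ (sym (sumFrom≡∑ 1 n (λ k → ⟦ suc n C k ⟧ * w (k ∸ 1) x * w (suc n ∸ k) x)))
                   (cong₂ (λ c k → ⟦ c ⟧ * w n x * w k x) (nCn≡1 (suc n)) (ℕ.n∸n≡0 n)) ⟩
    R + 1ℚ * w n x * 1ℚ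
      ≡⟨ cong (R +_) (trans (ℚ.*-identityʳ (1ℚ * w n x)) (ℚ.*-identityˡ (w n x))) ⟩
    R + w n x ∎
    where
    P : ℕ → ℚ
    P a = ⟦ suc n C suc a ⟧ * w a x * w (n ∸ a) x
    R = Σ[ 1 to n ] (λ k → ⟦ suc n C k ⟧ * w (k ∸ 1) x * w (suc n ∸ k) x)

theorem2 : (m : ℕ) → .{{_ : ℕ.NonZero m}} → (x : ℚ) →
    Hw m x ≡ (1ℚ + x - ⟦ m ⟧) * w (m ∸ 1) x
             + (1ℚ + x) * Σ[ 1 to m ∸ 1 ] (λ k → ⟦ m C k ⟧ * w (k ∸ 1) x * w (m ∸ k) x)
theorem2 (suc n) x = begin
  Hw (suc n) x                                  ≡⟨ Hw≡ℓ⊛w x (suc n) ⟩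
  ℓ⊛w x (suc n)                                 ≡⟨ x≈z//y _ _ _ ℓ⊛w-closed ⟩
  (1ℚ + x) * (R + w n x) - ⟦ suc n ⟧ * w n x    ≡⟨ rearrange R (w n x) ⟦ suc n ⟧ x ⟩
  (1ℚ + x - ⟦ suc n ⟧) * w n x + (1ℚ + x) * R   ∎
  where
  R = Σ[ 1 to n ] (λ k → ⟦ suc n C k ⟧ * w (k ∸ 1) x * w (suc n ∸ k) x)
  ℓ⊛w-closed : ℓ⊛w x (suc n) + ⟦ suc n ⟧ * w n x ≡ (1ℚ + x) * (R + w n x)
  ℓ⊛w-closed = trans (ℓ⊛w-suc x n) (cong ((1ℚ + x) *_) (∑-binomial-w x n))
  rearrange : ∀ s v c y → (1ℚ + y) * (s + v) - c * v ≡ (1ℚ + y - c) * v + (1ℚ + y) * s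
  rearrange = solve-∀ ℚ-ring
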